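{- Let $D$ be a minimal counterexample to the conjecture described in the context, $C$ its Hamilton cycle, and $x$ a vertex of $D$ none of whose incident edges is green, such that the edge from $x^-$ to $x$ is red (i.e. $x^-\in R^-(x)$). Then $R^+_r(x)$ and $R^-_r(x)$ are nonempty. Moreover, there is a vertex in $R^-_r(x)$ whose successor on $C$ does not lie in $B^+(x)$.
   Context: A 3-coloured tournament is a finite tournament each of whose edges is coloured red, blue or green. A triple of vertices spans a $T_3$ if the three edges between them form a directed cycle with three distinct colours. For distinct vertices $u,v$, $u$ monochromatically dominates $v$ in colour $c$ if there is a directed path from $u$ to $v$ all of whose edges have colour $c$. The conjecture: every 3-coloured tournament has a triple spanning a $T_3$ or a vertex monochromatically dominating every other vertex. A minimal counterexample is a 3-coloured tournament $D$ with no $T_3$ and no vertex dominating all others, such that every proper nonempty subtournament has a $T_3$ or a vertex monochromatically dominating all its other vertices within it. Such $D$ has a unique directed Hamilton cycle $C$ such that each vertex monochromatically dominates every vertex except its predecessor on $C$; $x^-$ denotes the predecessor of $x$ on $C$. Notation: $R^+(x)$ (resp. $R^-(x)$) is the set of vertices to which $x$ sends a red edge (resp. from which $x$ receives a red edge); $B^+(x)$, $B^-(x)$ are defined analogously for blue. For $i\in\{r,b\}$ (red, blue): $R^-_i(x)=\{v\in R^-(x): x \text{ dominates } v \text{ monochromatically in colour } i\}$, $R^+_i(x)=\{v\in R^+(x): v \text{ dominates } x \text{ monochromatically in colour } i\}$, and $B^-_i(x)$, $B^+_i(x)$ are defined analogously with $B^\pm(x)$ in place of $R^\pm(x)$. 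-}

module Defs where

open import Data.Nat using (ℕ; zero; suc)
open import Data.Fin using (Fin)
open import Data.Fin.Subset using (Subset; _∈_; _∉_; Nonempty)
open import Data.Product using (Σ; ∃; _×_; _,_)
open import Data.Sum using (_⊎_)
open import Data.Empty using (⊥)
open import Data.Unit using (⊤)
open import Relation.Nullary using (¬_)
open import Relation.Binary.PropositionalEquality using (_≡_; _≢_)
open import Function using (_∘_)

data Colour : Set where
  red blue green : Colour

-- A 3-coloured tournament on the vertex set Fin n.
-- 'arc u v' means the edge between u and v is directed from u to v;
-- the colour of that edge is 'colour u v' (values of 'colour' on
-- non-arcs are irrelevant).
record Tournament (n : ℕ) : Set₁ where
  field
    arc     : Fin n → Fin n → Set
    irrefl  : ∀ u → ¬ arc u u
    asym    : ∀ u v → arc u v → arc v u → ⊥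
    total   : ∀ u v → u ≢ v → arc u v ⊎ arc v u
    colour  : Fin n → Fin n → Colour

module _ {n : ℕ} (D : Tournament n) where
  open Tournament D

  Arc : Colour → Fin n → Fin n → Set
  Arc c u v = arc u v × colour u v ≡ c

  -- Directed walk from u to v (at least one edge), all edges of colour c,
  -- all vertices inside the vertex set P.  (A monochromatic walk exists iff
  -- a monochromatic path exists.)
  data MonoPathIn (P : Fin n → Set) (c : Colour) : Fin n → Fin n → Set where
    edge : ∀ {u v} → Arc c u v → MonoPathIn P c u v
    step : ∀ {u w v} → Arc c u w → P w → MonoPathIn P c w v → MonoPathIn P c u v

  DomIn : (Fin n → Set) → Fin n → Fin n → Set
  DomIn P u v = Σ Colour λ c → MonoPathIn P c u v

  MonoPath : Colour → Fin n → Fin n → Set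
  MonoPath = MonoPathIn (λ _ → ⊤)

  Dom : Fin n → Fin n → Set
  Dom = DomIn (λ _ → ⊤)

  T₃In : (Fin n → Set) → Set
  T₃In P = Σ (Fin n) λ x → Σ (Fin n) λ y → Σ (Fin n) λ z →
    P x × P y × P z × arc x y × arc y z × arc z x ×
    colour x y ≢ colour y z × colour y z ≢ colour z x × colour x y ≢ colour z x

  HasT₃ : Set
  HasT₃ = T₃In (λ _ → ⊤)

  HasDominatorIn : (Fin n → Set) → Set
  HasDominatorIn P = Σ (Fin n) λ v → P v × (∀ w → P w → w ≢ v → DomIn P v w)

  HasDominator : Set
  HasDominator = HasDominatorIn (λ _ → ⊤)

  record MinimalCounterexample : Set where
    field
      noT₃     : ¬ HasT₃
      noDom    : ¬ HasDominator
      minimal  : (S : Subset n) → Nonempty S → (Σ (Fin n) λ v → v ∉ S) →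
                 T₃In (_∈ S) ⊎ HasDominatorIn (_∈ S)

  iter : (Fin n → Fin n) → ℕ → Fin n → Fin n
  iter f zero    v = v
  iter f (suc k) v = f (iter f k v)

  -- A directed Hamilton cycle, given by successor and predecessor maps:
  -- every v → succ v is an arc, succ/pred are mutually inverse and
  -- succ has a single orbit (every vertex reachable from every vertex).
  record HamiltonCycle : Set where
    field
      succ      : Fin n → Fin n
      pred      : Fin n → Fin n
      succ-pred : ∀ v → succ (pred v) ≡ v
      pred-succ : ∀ v → pred (succ v) ≡ v
      arcs      : ∀ v → arc v (succ v)
      oneOrbit  : ∀ u v → ∃ λ k → iter succ k u ≡ v

  -- The cycle C of a minimal counterexample: each vertex dominates every
  -- vertex other than itself and its predecessor on C.
  DominationCycle : HamiltonCycle → Set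
  DominationCycle C = ∀ u v → v ≢ u → v ≢ HamiltonCycle.pred C u → Dom u v

  R⁺ R⁻ B⁺ B⁻ : Fin n → Fin n → Set
  R⁺ x v = Arc red x v
  R⁻ x v = Arc red v x
  B⁺ x v = Arc blue x v
  B⁻ x v = Arc blue v x

  R⁻ᵣ R⁺ᵣ : Fin n → Fin n → Set
  R⁻ᵣ x v = R⁻ x v × MonoPath red x v
  R⁺ᵣ x v = R⁺ x v × MonoPath red v x

  NoGreenAt : Fin n → Set
  NoGreenAt x = ∀ y → (arc x y → colour x y ≢ green) × (arc y x → colour y x ≢ green)

module Submission where

-- Write
-- RedTo v / RedFrom v for "v reaches x" / "x reaches v" by a red path (BlueTo,
-- BlueFrom likewise).  Since no u dominates pred u, RedTo u rules out
-- RedFrom (pred u) and BlueTo u rules out BlueFrom (pred u).  Minimality gives: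
-- the initial vertex of a proper interval of C dominates it inside it; and a
-- green path from a blue out-neighbour to a red in-neighbour of x through
-- vertices that x splits (blue arc to them, red arc from them) closes a T₃.
-- Together: a blue arc from x to a vertex q behind x forces RedTo q, provided
-- the vertices between q and x⁻ are not on red closed walks through x
-- (blue-arc⇒red-to).  Without a red closed walk through x, the first vertex b
-- behind x⁻ with ¬ RedTo b receives a blue arc from x, a contradiction.  With
-- one, its first vertex lies in R⁺_r(x), and its vertex v closest to x behind x
-- has a red arc to x and no blue arc from x to v⁺.

open import Defs
open import Data.Nat using (ℕ; zero; suc; _+_; _≤_; _<_; _≤′_; _≤‴_; ≤′-refl; ≤′-step; ≤‴-refl; ≤‴-step; z≤n; s≤s; 2+)
open import Data.Nat.Properties
  using (≤-refl; ≤-trans; <⇒≤; <-≤-trans; <-trans; <-irrefl; n<1+n; m≤n⇒m≤1+n;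
         ≤∧≢⇒<; m≤n⇒m<n∨m≡n; <⇒≢; >⇒≢; <⇒≱; n≢0⇒n>0; m<m+n; m≤n+m; +-comm; +-suc;
         ≤⇒≤′; ≤′⇒≤; ≤⇒≤‴; ≤‴⇒≤; m≤n⇒∃[o]m+o≡n; ≰⇒>; <-cmp; _≤?_)
open import Data.Fin using (Fin; _≟_)
open import Data.Fin.Subset using (Subset; _∈_)
open import Data.Product using (Σ; _×_; _,_; proj₁; proj₂; map₂)
open import Data.Sum using (_⊎_; inj₁; inj₂)
open import Data.Empty using (⊥; ⊥-elim)
open import Data.Unit using (tt)
open import Data.List using (List; []; _∷_; allFin)
open import Data.List.Relation.Unary.Any using (here; there)
open import Data.List.Membership.Propositional using () renaming (_∈_ to _∈ₗ_)
open import Data.List.Membership.Propositional.Properties using (∈-allFin)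
open import Data.Vec using (tabulate)
open import Data.Vec.Properties using (lookup∘tabulate; []=⇒lookup; lookup⇒[]=)
open import Function using (_∘_)
open import Relation.Binary.Definitions using (tri<; tri≈; tri>)
open import Relation.Unary using (Decidable)
open import Relation.Nullary using (¬_; Dec; yes; no; does; ¬?)
open import Relation.Nullary.Decidable using (map′; _×-dec_; _⊎-dec_; dec-true; decidable-stable)
open import Relation.Binary.PropositionalEquality using (_≡_; _≢_; refl; sym; trans; cong; subst)
open import Relation.Binary.PropositionalEquality using (module ≡-Reasoning)

least : ∀ {P : ℕ → Set} → Decidable P → ∀ {k} → P k →
        Σ ℕ λ j → j ≤ k × P j × (∀ {i} → i < j → ¬ P i)
least P? pk with P? 0
... | yes p0 = 0 , z≤n , p0 , λ ()
least P? {zero} p0 | no ¬p0 = ⊥-elim (¬p0 p0)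
least {P} P? {suc k} pk | no ¬p0 with least (P? ∘ suc) pk
... | j , j≤k , pj , below = suc j , s≤s j≤k , pj , minimal
  where
  minimal : ∀ {i} → i < suc j → ¬ P i
  minimal {zero} _ = ¬p0
  minimal {suc i} (s≤s i<j) = below i<j

induction-upward : ∀ {P : ℕ → Set} {lo hi} → P lo →
                   (∀ {i} → lo ≤ i → suc i < hi → P i → P (suc i)) →
                   ∀ {i} → lo ≤ i → i < hi → P i
induction-upward {P} {lo} {hi} base next lo≤i = go (≤⇒≤′ lo≤i)
  where
  go : ∀ {i} → lo ≤′ i → i < hi → P i
  go ≤′-refl _ = base
  go (≤′-step lo≤′i) i<hi = next (≤′⇒≤ lo≤′i) i<hi (go lo≤′i (<-trans (n<1+n _) i<hi))

induction-downward : ∀ {P : ℕ → Set} {lo hi} → P hi →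
                     (∀ {i} → lo ≤ i → i < hi → P (suc i) → P i) →
                     ∀ {i} → lo ≤ i → i ≤ hi → P i
induction-downward {P} {lo} {hi} base next lo≤i i≤hi = go lo≤i (≤⇒≤‴ i≤hi)
  where
  go : ∀ {i} → lo ≤ i → i ≤‴ hi → P i
  go _ ≤‴-refl = base
  go lo≤i (≤‴-step i<‴hi) = next lo≤i (≤‴⇒≤ i<‴hi) (go (m≤n⇒m≤1+n lo≤i) i<‴hi)

_≟ᶜ_ : (c d : Colour) → Dec (c ≡ d)
red   ≟ᶜ red   = yes refl
red   ≟ᶜ blue  = no λ ()
red   ≟ᶜ green = no λ ()
blue  ≟ᶜ red   = no λ ()
blue  ≟ᶜ blue  = yes refl
blue  ≟ᶜ green = no λ ()
green ≟ᶜ red   = no λ ()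
green ≟ᶜ blue  = no λ ()
green ≟ᶜ green = yes refl

is-blue : ∀ {c} → c ≢ green → c ≢ red → c ≡ blue
is-blue {red}   _ ¬red   = ⊥-elim (¬red refl)
is-blue {blue}  _ _      = refl
is-blue {green} ¬green _ = ⊥-elim (¬green refl)

is-red : ∀ {c} → c ≢ green → c ≢ blue → c ≡ red
is-red {red}   _ _       = refl
is-red {blue}  _ ¬blue   = ⊥-elim (¬blue refl)
is-red {green} ¬green _  = ⊥-elim (¬green refl)

red-or-blue : ∀ {Q : Colour → Set} → Σ Colour Q → (∀ {c} → Q c → c ≢ green) → Q red ⊎ Q blue
red-or-blue (red   , q) _      = inj₁ q
red-or-blue (blue  , q) _      = inj₂ q
red-or-blue (green , q) ¬green = ⊥-elim (¬green q refl)

module Walks {n : ℕ} (D : Tournament n) where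
  open Tournament D

  arc? : ∀ u v → Dec (arc u v)
  arc? u v with u ≟ v
  ... | yes refl = no (irrefl u)
  ... | no u≢v with total u v u≢v
  ...   | inj₁ uv = yes uv
  ...   | inj₂ vu = no (asym v u vu)

  colouredArc? : ∀ c u v → Dec (Arc D c u v)
  colouredArc? c u v = arc? u v ×-dec (colour u v ≟ᶜ c)

  widen : ∀ {P Q : Fin n → Set} → (∀ {w} → P w → Q w) →
          ∀ {c u v} → MonoPathIn D P c u v → MonoPathIn D Q c u v
  widen P⊆Q (edge a)     = edge a
  widen P⊆Q (step a p r) = step a (P⊆Q p) (widen P⊆Q r)

  forget : ∀ {P : Fin n → Set} {c u v} → MonoPathIn D P c u v → MonoPath D c u v
  forget = widen (λ _ → tt)

  _++⟨_⟩_ : ∀ {P : Fin n → Set} {c u w v} →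
            MonoPathIn D P c u w → P w → MonoPathIn D P c w v → MonoPathIn D P c u v
  edge a     ++⟨ pw ⟩ r = step a pw r
  step a p q ++⟨ pw ⟩ r = step a p (q ++⟨ pw ⟩ r)

  _++_ : ∀ {c u w v} → MonoPath D c u w → MonoPath D c w v → MonoPath D c u v
  p ++ q = p ++⟨ tt ⟩ q

  first-step : ∀ {P : Fin n → Set} {c u v} → MonoPathIn D P c u v →
               Σ (Fin n) λ g → Arc D c u g × (g ≡ v ⊎ (P g × MonoPathIn D P c g v))
  first-step (edge a)     = _ , a , inj₁ refl
  first-step (step a p r) = _ , a , inj₂ (p , r)

  last-step : ∀ {P : Fin n → Set} {c u v} → MonoPathIn D P c u v →
              Σ (Fin n) λ w → Arc D c w v × (w ≡ u ⊎ (P w × MonoPathIn D P c u w))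
  last-step (edge a) = _ , a , inj₁ refl
  last-step (step a pm r) with last-step r
  ... | w , a' , inj₁ refl      = w , a' , inj₂ (pm , edge a)
  ... | w , a' , inj₂ (pw , r') = w , a' , inj₂ (pw , step a pm r')

  -- Reachability is decidable: allowing one more intermediate vertex w adds
  -- exactly the walks that pass through w (Floyd–Warshall).
  through : ∀ {S w c u v} → MonoPathIn D (_∈ₗ (w ∷ S)) c u v →
            MonoPathIn D (_∈ₗ S) c u v ⊎ (MonoPathIn D (_∈ₗ S) c u w × MonoPathIn D (_∈ₗ S) c w v)
  through (edge a) = inj₁ (edge a)
  through (step a (here refl) r) with through r
  ... | inj₁ p       = inj₂ (edge a , p)
  ... | inj₂ (_ , q) = inj₂ (edge a , q)
  through (step a (there m) r) with through r
  ... | inj₁ p       = inj₁ (step a m p)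
  ... | inj₂ (p , q) = inj₂ (step a m p , q)

  monoPathVia? : ∀ S c u v → Dec (MonoPathIn D (_∈ₗ S) c u v)
  monoPathVia? [] c u v = map′ edge only-edge (colouredArc? c u v)
    where
    only-edge : MonoPathIn D (_∈ₗ []) c u v → Arc D c u v
    only-edge (edge a) = a
  monoPathVia? (w ∷ S) c u v =
    map′ via-w through (monoPathVia? S c u v ⊎-dec (monoPathVia? S c u w ×-dec monoPathVia? S c w v))
    where
    via-w : MonoPathIn D (_∈ₗ S) c u v ⊎ (MonoPathIn D (_∈ₗ S) c u w × MonoPathIn D (_∈ₗ S) c w v) →
            MonoPathIn D (_∈ₗ (w ∷ S)) c u v
    via-w (inj₁ p)       = widen there p
    via-w (inj₂ (p , q)) = widen there p ++⟨ here refl ⟩ widen there q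

  monoPath? : ∀ c u v → Dec (MonoPath D c u v)
  monoPath? c u v = map′ forget (widen (λ {w} _ → ∈-allFin w)) (monoPathVia? (allFin n) c u v)

  ⟦_⟧ : {Q : Fin n → Set} → Decidable Q → Subset n
  ⟦ Q? ⟧ = tabulate (does ∘ Q?)

  ∈⟦⟧⁺ : ∀ {Q : Fin n → Set} (Q? : Decidable Q) {w} → Q w → w ∈ ⟦ Q? ⟧
  ∈⟦⟧⁺ Q? {w} q = lookup⇒[]= w ⟦ Q? ⟧ (trans (lookup∘tabulate (does ∘ Q?) w) (dec-true (Q? w) q))

  ∈⟦⟧⁻ : ∀ {Q : Fin n → Set} (Q? : Decidable Q) {w} → w ∈ ⟦ Q? ⟧ → Q w
  ∈⟦⟧⁻ Q? {w} w∈ with Q? w | trans (sym (lookup∘tabulate (does ∘ Q?) w)) ([]=⇒lookup w∈)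
  ... | yes q | _ = q
  ... | no _  | ()

  Split : Fin n → Fin n → Set
  Split x g = (arc x g → colour x g ≡ blue) × (arc g x → colour g x ≡ red)

  rainbow : ∀ {x u w} → Arc D blue x u → Arc D green u w → Arc D red w x → HasT₃ D
  rainbow (a₁ , c₁) (a₂ , c₂) (a₃ , c₃) =
    _ , _ , _ , tt , tt , tt , a₁ , a₂ , a₃ , differ c₁ c₂ (λ ()) , differ c₂ c₃ (λ ()) , differ c₁ c₃ (λ ())
    where
    differ : ∀ {a b c d : Colour} → a ≡ c → b ≡ d → c ≢ d → a ≢ b
    differ refl refl c≢d = c≢d

  -- A green path from a blue out-neighbour of x to a red in-neighbour of x,
  -- through vertices split by x, yields a T₃: somewhere an edge of the path
  -- goes from the blue side to the red side.
  green-bridge : ∀ {x} → ¬ HasT₃ D → (∀ {u} → ¬ Arc D green u x) →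
                 ∀ {P : Fin n → Set} → (∀ {g} → P g → g ≢ x → Split x g) →
                 ∀ {u w} → MonoPathIn D P green u w → Arc D blue x u → Arc D red w x → ⊥
  green-bridge noT₃ _ _ (edge a) x→u w→x = noT₃ (rainbow x→u a w→x)
  green-bridge {x} noT₃ no-green-in splits (step {w = m} a m∈P r) x→u w→x with m ≟ x
  ... | yes refl = no-green-in a
  ... | no m≢x with total x m (m≢x ∘ sym)
  ...   | inj₁ x→m = green-bridge noT₃ no-green-in splits r (x→m , proj₁ (splits m∈P m≢x) x→m) w→x
  ...   | inj₂ m→x = noT₃ (rainbow x→u a (m→x , proj₂ (splits m∈P m≢x) m→x))

module OnCycle {n : ℕ} {D : Tournament n} (C : HamiltonCycle D) where
  open Tournament D
  open HamiltonCycle C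
  open ≡-Reasoning

  pred-injective : ∀ {u v} → pred u ≡ pred v → u ≡ v
  pred-injective {u} {v} e = begin
    u               ≡⟨ sym (succ-pred u) ⟩
    succ (pred u)   ≡⟨ cong succ e ⟩
    succ (pred v)   ≡⟨ succ-pred v ⟩
    v               ∎

  succ≢ : ∀ v → succ v ≢ v
  succ≢ v e = irrefl v (subst (arc v) e (arcs v))

  pred≢ : ∀ v → pred v ≢ v
  pred≢ v e = irrefl v (subst (λ t → arc t v) e (subst (arc (pred v)) (succ-pred v) (arcs (pred v))))

  iter-shift : ∀ (f : Fin n → Fin n) k v → iter D f (suc k) v ≡ iter D f k (f v)
  iter-shift f zero    v = refl
  iter-shift f (suc k) v = cong f (iter-shift f k v)

  iter-pred-succ : ∀ k w → iter D pred k (iter D succ k w) ≡ w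
  iter-pred-succ zero    w = refl
  iter-pred-succ (suc k) w = begin
    iter D pred (suc k) (succ (iter D succ k w))  ≡⟨ iter-shift pred k _ ⟩
    iter D pred k (pred (succ (iter D succ k w))) ≡⟨ cong (iter D pred k) (pred-succ _) ⟩
    iter D pred k (iter D succ k w)               ≡⟨ iter-pred-succ k w ⟩
    w                                             ∎

  iter-pred-injective : ∀ a {u v} → iter D pred a u ≡ iter D pred a v → u ≡ v
  iter-pred-injective zero    e = e
  iter-pred-injective (suc a) e = iter-pred-injective a (pred-injective e)

  -- Coordinates relative to x: back j is reached from x by j steps backwards
  -- along C, and pos w is the least such j for w.  Positions run over
  -- 0 … last, where back 0 = x, back 1 = x⁻ and back last = x⁺.
  module Coordinates (x : Fin n) where

    back : ℕ → Fin n
    back j = iter D pred j x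

    back-surjective : ∀ w → Σ ℕ λ k → back k ≡ w
    back-surjective w with oneOrbit w x
    ... | k , succᵏw≡x = k , trans (cong (iter D pred k) (sym succᵏw≡x)) (iter-pred-succ k w)

    back-+ : ∀ a b → back (a + b) ≡ iter D pred a (back b)
    back-+ zero    b = refl
    back-+ (suc a) b = cong pred (back-+ a b)

    private
      first-visit : ∀ w → Σ ℕ λ j → j ≤ proj₁ (back-surjective w) × back j ≡ w × (∀ {i} → i < j → ¬ back i ≡ w)
      first-visit w = least {P = λ j → back j ≡ w} (λ j → back j ≟ w) (proj₂ (back-surjective w))

    opaque
      pos : Fin n → ℕ
      pos w = proj₁ (first-visit w)

      back-pos : ∀ w → back (pos w) ≡ w
      back-pos w = proj₁ (proj₂ (proj₂ (first-visit w)))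

      pos-minimal : ∀ w {i} → i < pos w → back i ≢ w
      pos-minimal w = proj₂ (proj₂ (proj₂ (first-visit w)))

    pos-determines : ∀ {w i} → pos w ≡ i → w ≡ back i
    pos-determines {w} e = trans (sym (back-pos w)) (cong back e)

    last : ℕ
    last = pos (succ x)

    back-last : back last ≡ succ x
    back-last = back-pos (succ x)

    1≤last : 1 ≤ last
    1≤last = n≢0⇒n>0 (λ e → succ≢ x (trans (sym back-last) (cong back e)))

    back-suc-last : back (suc last) ≡ x
    back-suc-last = trans (cong pred back-last) (pred-succ x)

    -- Past position last the walk returns to x, so no position exceeds last.
    pos-≤-last : ∀ w → pos w ≤ last
    pos-≤-last w with pos w ≤? last
    ... | yes pos≤last = pos≤last
    ... | no pos≰last with m≤n⇒∃[o]m+o≡n (≰⇒> pos≰last)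
    ...   | d , suc-last+d≡pos = ⊥-elim (pos-minimal w d<pos back-d≡w)
      where
      pos≡ : pos w ≡ d + suc last
      pos≡ = trans (sym suc-last+d≡pos) (+-comm (suc last) d)
      back-d≡w : back d ≡ w
      back-d≡w = begin
        back d                          ≡⟨ cong (iter D pred d) (sym back-suc-last) ⟩
        iter D pred d (back (suc last)) ≡⟨ sym (back-+ d (suc last)) ⟩
        back (d + suc last)             ≡⟨ cong back (sym pos≡) ⟩
        back (pos w)                    ≡⟨ back-pos w ⟩
        w                               ∎
      d<pos : d < pos w
      d<pos = subst (d <_) (sym pos≡) (m<m+n d (s≤s z≤n))

    -- Within 0 … last the walk back from x visits no vertex twice: a repeat
    -- back i = back (i + 1 + d) would give back (1 + d) = x, i.e. back d = x⁺
    -- with d < last.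
    no-early-return : ∀ {i j} → i < j → j ≤ last → back i ≢ back j
    no-early-return {i} {j} i<j j≤last e with m≤n⇒∃[o]m+o≡n i<j
    ... | d , suc-i+d≡j = pos-minimal (succ x) d<last (sym succ-x≡back-d)
      where
      x≡back-suc-d : x ≡ back (suc d)
      x≡back-suc-d = iter-pred-injective i (begin
        back i                        ≡⟨ e ⟩
        back j                        ≡⟨ cong back (sym (trans (+-suc i d) suc-i+d≡j)) ⟩
        back (i + suc d)              ≡⟨ back-+ i (suc d) ⟩
        iter D pred i (back (suc d))  ∎)
      succ-x≡back-d : succ x ≡ back d
      succ-x≡back-d = trans (cong succ x≡back-suc-d) (succ-pred (back d))
      d<last : d < last
      d<last = <-≤-trans (subst (d <_) suc-i+d≡j (s≤s (m≤n+m d i))) j≤last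

    back-injective : ∀ {i j} → i ≤ last → j ≤ last → back i ≡ back j → i ≡ j
    back-injective {i} {j} i≤last j≤last e with <-cmp i j
    ... | tri≈ _ i≡j _ = i≡j
    ... | tri< i<j _ _ = ⊥-elim (no-early-return i<j j≤last e)
    ... | tri> _ _ j<i = ⊥-elim (no-early-return j<i i≤last (sym e))

    pos-back : ∀ {j} → j ≤ last → pos (back j) ≡ j
    pos-back {j} j≤last = back-injective (pos-≤-last (back j)) j≤last (back-pos (back j))

    pos-pred : ∀ {p} → pos p < last → pos (pred p) ≡ suc (pos p)
    pos-pred {p} pos<last = trans (cong (pos ∘ pred) (sym (back-pos p))) (pos-back pos<last)

    -- The interval of C from back hi forwards to back lo.  Its initial vertex
    -- (in the order of C) is back hi, and it is closed under pred elsewhere.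
    Seg : ℕ → ℕ → Fin n → Set
    Seg lo hi w = lo ≤ pos w × pos w ≤ hi

    seg? : ∀ lo hi → Decidable (Seg lo hi)
    seg? lo hi w = (lo ≤? pos w) ×-dec (pos w ≤? hi)

    back-∈-Seg : ∀ {lo hi} → lo ≤ hi → hi ≤ last → Seg lo hi (back hi)
    back-∈-Seg {lo} {hi} lo≤hi hi≤last =
      subst (λ t → lo ≤ t × t ≤ hi) (sym (pos-back hi≤last)) (lo≤hi , ≤-refl)

    Seg-pred-closed : ∀ {lo hi} → hi ≤ last → ∀ {p} → Seg lo hi p → p ≢ back hi → Seg lo hi (pred p)
    Seg-pred-closed {lo} {hi} hi≤last {p} (lo≤pos , pos≤hi) p≢initial =
      subst (λ t → lo ≤ t × t ≤ hi) (sym (pos-pred (<-≤-trans pos<hi hi≤last))) (m≤n⇒m≤1+n lo≤pos , pos<hi)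
      where
      pos<hi : pos p < hi
      pos<hi = ≤∧≢⇒< pos≤hi (p≢initial ∘ pos-determines)

module Counterexample {n : ℕ} {D : Tournament n} (M : MinimalCounterexample D)
                      (C : HamiltonCycle D) (DC : DominationCycle D C) where
  open MinimalCounterexample M
  open HamiltonCycle C
  open Walks D
  open OnCycle C

  -- No vertex dominates its predecessor: it would then dominate everything.
  no-dom-pred : ∀ u → ¬ Dom D u (pred u)
  no-dom-pred u u⇝pred = noDom (u , tt , λ w _ w≢u → dominates w w≢u)
    where
    dominates : ∀ w → w ≢ u → Dom D u w
    dominates w w≢u with w ≟ pred u
    ... | yes refl  = u⇝pred
    ... | no w≢pred = DC u w w≢u w≢pred

  -- The initial vertex h of a proper interval Q of C (the only vertex of Q whose
  -- predecessor may leave Q) dominates all of Q within Q: by minimality some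
  -- vertex of Q does, and it cannot be one whose predecessor lies in Q.
  initial-dominates : (Q : Fin n → Set) → Decidable Q → ∀ {h} → Q h → ∀ {w} → ¬ Q w →
                      (∀ {p} → Q p → p ≢ h → Q (pred p)) →
                      ∀ {u} → Q u → u ≢ h → DomIn D Q h u
  initial-dominates Q Q? {h} h∈Q {w} w∉Q closed {u} u∈Q u≢h
    with minimal ⟦ Q? ⟧ (h , ∈⟦⟧⁺ Q? h∈Q) (w , w∉Q ∘ ∈⟦⟧⁻ Q?)
  ... | inj₁ (a , b , c , _ , _ , _ , t₃) = ⊥-elim (noT₃ (a , b , c , tt , tt , tt , t₃))
  ... | inj₂ (p , p∈ , p-dominates) with p ≟ h
  ...   | yes refl = map₂ (widen (∈⟦⟧⁻ Q?)) (p-dominates u (∈⟦⟧⁺ Q? u∈Q) u≢h)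
  ...   | no p≢h = ⊥-elim (no-dom-pred p (map₂ forget
            (p-dominates (pred p) (∈⟦⟧⁺ Q? (closed (∈⟦⟧⁻ Q? p∈) p≢h)) (pred≢ p))))

module AtGreenFreeVertex {n : ℕ} {D : Tournament n} (M : MinimalCounterexample D)
                         (C : HamiltonCycle D) (DC : DominationCycle D C) (x : Fin n)
                         (no-green : NoGreenAt D x) (x⁻→x : R⁻ D x (HamiltonCycle.pred C x)) where
  open Tournament D
  open MinimalCounterexample M using (noT₃)
  open HamiltonCycle C
  open Walks D
  open OnCycle C
  open Coordinates x
  open Counterexample M C DC

  x⁻ x⁺ : Fin n
  x⁻ = pred x
  x⁺ = succ x

  RedTo RedFrom BlueTo BlueFrom : Fin n → Set
  RedTo    v = MonoPath D red  v x
  RedFrom  v = MonoPath D red  x v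
  BlueTo   v = MonoPath D blue v x
  BlueFrom v = MonoPath D blue x v

  x⁺↛x : ∀ {c} → ¬ MonoPath D c x⁺ x
  x⁺↛x p = no-dom-pred x⁺ (_ , subst (MonoPath D _ x⁺) (sym (pred-succ x)) p)

  x↛x⁻ : ∀ {c} → ¬ MonoPath D c x x⁻
  x↛x⁻ p = no-dom-pred x (_ , p)

  no-green-into-x : ∀ {u} → ¬ Arc D green u x
  no-green-into-x (a , c) = proj₂ (no-green _) a c

  green-free-into : ∀ {P : Fin n → Set} {c u} → MonoPathIn D P c u x → c ≢ green
  green-free-into p c≡green with last-step p
  ... | _ , (a , c) , _ = no-green-into-x (a , trans c c≡green)

  green-free-from : ∀ {P : Fin n → Set} {c v} → MonoPathIn D P c x v → c ≢ green
  green-free-from p c≡green with first-step p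
  ... | g , (a , c) , _ = proj₁ (no-green g) a (trans c c≡green)

  reaches-x : ∀ {v} → v ≢ x → v ≢ x⁺ → RedTo v ⊎ BlueTo v
  reaches-x {v} v≢x v≢x⁺ =
    red-or-blue (DC v x (v≢x ∘ sym) (λ x≡pred → v≢x⁺ (trans (sym (succ-pred v)) (cong succ (sym x≡pred)))))
                green-free-into

  reached-from-x : ∀ {v} → v ≢ x → v ≢ x⁻ → RedFrom v ⊎ BlueFrom v
  reached-from-x v≢x v≢x⁻ = red-or-blue (DC x _ v≢x v≢x⁻) green-free-from

  -- Passing through x, u must not reach pred u in one colour.
  red-break : ∀ {u} → RedTo u → ¬ RedFrom (pred u)
  red-break to from = no-dom-pred _ (red , to ++ from)

  blue-break : ∀ {u} → BlueTo u → ¬ BlueFrom (pred u)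
  blue-break to from = no-dom-pred _ (blue , to ++ from)

  blue-to⇒red-from-pred : ∀ {u} → BlueTo u → u ≢ x → u ≢ x⁺ → RedFrom (pred u)
  blue-to⇒red-from-pred {u} to u≢x u≢x⁺ with reached-from-x {pred u} (u≢x⁺ ∘ pred≡x) (u≢x ∘ pred-injective)
    where
    pred≡x : pred u ≡ x → u ≡ x⁺
    pred≡x e = trans (sym (succ-pred u)) (cong succ e)
  ... | inj₁ from = from
  ... | inj₂ from = ⊥-elim (blue-break to from)

  blue-from-pred⇒red-to : ∀ {u} → BlueFrom (pred u) → u ≢ x → u ≢ x⁺ → RedTo u
  blue-from-pred⇒red-to from u≢x u≢x⁺ with reaches-x u≢x u≢x⁺
  ... | inj₁ to = to
  ... | inj₂ to = ⊥-elim (blue-break to from)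

  red-and-blue-to : ∀ {u} → RedTo u → BlueTo u → u ≢ x → ⊥
  red-and-blue-to {u} red-to blue-to u≢x =
    red-break red-to (blue-to⇒red-from-pred blue-to u≢x (λ u≡x⁺ → x⁺↛x (subst RedTo u≡x⁺ red-to)))

  splits : ∀ {g} → ¬ RedFrom g → ¬ BlueTo g → Split x g
  splits {g} ¬red-from ¬blue-to =
    (λ a → is-blue (proj₁ (no-green g) a) (λ c → ¬red-from (edge (a , c)))) ,
    (λ a → is-red  (proj₂ (no-green g) a) (λ c → ¬blue-to (edge (a , c))))

  pos-x : pos x ≡ 0
  pos-x = pos-back z≤n

  pos-x⁻ : pos x⁻ ≡ 1
  pos-x⁻ = pos-back 1≤last

  back≢x : ∀ {i} → 1 ≤ i → i ≤ last → back i ≢ x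
  back≢x 1≤i i≤last = >⇒≢ 1≤i ∘ back-injective i≤last z≤n

  back≢x⁻ : ∀ {i} → 2 ≤ i → i ≤ last → back i ≢ x⁻
  back≢x⁻ 2≤i i≤last = >⇒≢ 2≤i ∘ back-injective i≤last 1≤last

  back≢x⁺ : ∀ {i} → i < last → back i ≢ x⁺
  back≢x⁺ i<last e = <⇒≢ i<last (back-injective (<⇒≤ i<last) ≤-refl (trans e (sym back-last)))

  segment-dominates : ∀ {lo hi} → lo ≤ hi → hi ≤ last → ∀ {w} → ¬ Seg lo hi w →
                      ∀ {u} → Seg lo hi u → u ≢ back hi → DomIn D (Seg lo hi) (back hi) u
  segment-dominates {lo} {hi} lo≤hi hi≤last w∉ =
    initial-dominates (Seg lo hi) (seg? lo hi) (back-∈-Seg lo≤hi hi≤last) w∉ (Seg-pred-closed hi≤last)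

  -- No vertex strictly between back k and x reaches x in red and is red-reachable
  -- from x, i.e. none of them lies on a red closed walk through x.
  OffRedCyclesBelow : ℕ → Set
  OffRedCyclesBelow k = ∀ {i} → 1 ≤ i → i < k → RedTo (back i) → ¬ RedFrom (back i)

  -- Below a blue arc x → back k, going forwards from back k to x⁻: each vertex
  -- back (1 + i) is blue-reachable from x, so back i reaches x in red and,
  -- being off the red closed walks, is in turn blue-reachable from x.
  red-to-below : ∀ {k} → k ≤ last → Arc D blue x (back k) → OffRedCyclesBelow k →
                 ∀ {i} → 1 ≤ i → i < k → RedTo (back i)
  red-to-below {k} k≤last x→q off-cycle 1≤i i<k =
    red-to-from-successor 1≤i i<k (blue-from (s≤s 1≤i) i<k)
    where
    red-to-from-successor : ∀ {i} → 1 ≤ i → i < k → BlueFrom (back (suc i)) → RedTo (back i)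
    red-to-from-successor 1≤i i<k from-pred = blue-from-pred⇒red-to from-pred
      (back≢x 1≤i (<⇒≤ (<-≤-trans i<k k≤last))) (back≢x⁺ (<-≤-trans i<k k≤last))

    blue-from : ∀ {i} → 2 ≤ i → i ≤ k → BlueFrom (back i)
    blue-from = induction-downward {P = BlueFrom ∘ back} (edge x→q) descend
      where
      descend : ∀ {i} → 2 ≤ i → i < k → BlueFrom (back (suc i)) → BlueFrom (back i)
      descend {i} 2≤i i<k from-pred
        with reached-from-x (back≢x (<⇒≤ 2≤i) i≤last) (back≢x⁻ 2≤i i≤last)
        where
        i≤last : i ≤ last
        i≤last = <⇒≤ (<-≤-trans i<k k≤last)
      ... | inj₂ from = from
      ... | inj₁ from = ⊥-elim (off-cycle (<⇒≤ 2≤i) i<k (red-to-from-successor (<⇒≤ 2≤i) i<k from-pred) from)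

  -- By red-to-below, x splits the
  -- interval from q forwards to x⁻; in it q dominates x⁻, and that path can
  -- only be red: blue makes x reach x⁻, green closes a T₃.
  blue-arc⇒red-to : ∀ {k} → 1 ≤ k → k ≤ last → Arc D blue x (back k) → OffRedCyclesBelow k →
                    RedTo (back k)
  blue-arc⇒red-to {suc zero} _ _ _ _ = edge x⁻→x
  blue-arc⇒red-to {k@(2+ _)} _ k≤last x→q off-cycle with segment-dominates (s≤s z≤n) k≤last x∉Seg x⁻∈Seg x⁻≢q
    where
    x∉Seg : ¬ Seg 1 k x
    x∉Seg (1≤pos , _) = <-irrefl refl (subst (1 ≤_) pos-x 1≤pos)
    x⁻∈Seg : Seg 1 k x⁻
    x⁻∈Seg = subst (λ t → 1 ≤ t × t ≤ k) (sym pos-x⁻) (≤-refl , s≤s z≤n)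
    x⁻≢q : x⁻ ≢ back k
    x⁻≢q = back≢x⁻ (s≤s (s≤s z≤n)) k≤last ∘ sym
  ... | red   , p = forget p ++ edge x⁻→x
  ... | blue  , p = ⊥-elim (x↛x⁻ (edge x→q ++ forget p))
  ... | green , p = ⊥-elim (green-bridge noT₃ no-green-into-x x-splits p x→q x⁻→x)
    where
    x-splits : ∀ {g} → Seg 1 k g → g ≢ x → Split x g
    x-splits {g} (1≤pos , pos≤k) g≢x with g ≟ back k
    ... | yes refl = (λ _ → proj₂ x→q) , (λ q→x → ⊥-elim (asym x g (proj₁ x→q) q→x))
    ... | no g≢q = splits (off-cycle 1≤pos pos<k red-to ∘ subst RedFrom (sym (back-pos g)))
                          (λ blue-to → red-and-blue-to (subst RedTo (back-pos g) red-to) blue-to g≢x)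
      where
      pos<k : pos g < k
      pos<k = ≤∧≢⇒< pos≤k (g≢q ∘ pos-determines)
      red-to : RedTo (back (pos g))
      red-to = red-to-below k≤last x→q off-cycle 1≤pos pos<k

  module WithoutRedCycle (no-cycle : ¬ RedFrom x) where

    not-both : ∀ {v} → RedTo v → ¬ RedFrom v
    not-both to from = no-cycle (from ++ to)

    -- If x⁺ is not red-reachable, nothing is: red reachability would propagate
    -- backwards along C up to x⁺.  Then x splits every other vertex.
    nothing-red-reachable : ¬ RedFrom x⁺ → ∀ {w} → ¬ RedFrom w
    nothing-red-reachable ¬from {w} from =
      ¬from (subst RedFrom back-last
        (induction-upward {P = RedFrom ∘ back} (subst RedFrom (sym (back-pos w)) from) ascend
                          (pos-≤-last w) ≤-refl))
      where
      not-x : ∀ {v} → RedFrom v → v ≢ x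
      not-x from-v v≡x = no-cycle (subst RedFrom v≡x from-v)
      ascend : ∀ {i} → pos w ≤ i → suc i < suc last → RedFrom (back i) → RedFrom (back (suc i))
      ascend _ (s≤s i<last) from-i with reaches-x (not-x from-i) (back≢x⁺ i<last)
      ... | inj₁ to = ⊥-elim (not-both to from-i)
      ... | inj₂ to = blue-to⇒red-from-pred to (not-x from-i) (back≢x⁺ i<last)

    splits-all : ¬ RedFrom x⁺ → ∀ {g} → g ≢ x → Split x g
    splits-all ¬from g≢x = splits (nothing-red-reachable ¬from)
      (λ to → nothing-red-reachable ¬from (blue-to⇒red-from-pred to g≢x (λ e → x⁺↛x (subst BlueTo e to))))

    -- So x⁺ is red-reachable: otherwise the path by which x⁺ dominates x⁻ can
    -- be neither red, nor blue (x → x⁺ is blue), nor green.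
    x⁺-red-reachable : RedFrom x⁺
    x⁺-red-reachable with monoPath? red x x⁺
    ... | yes from = from
    ... | no ¬from with DC x⁺ x⁻ x⁻≢x⁺ (pred≢ x ∘ λ e → trans e (pred-succ x))
      where
      x⁻≢x⁺ : x⁻ ≢ x⁺
      x⁻≢x⁺ e = asym x x⁺ (arcs x) (subst (λ t → arc t x) e (proj₁ x⁻→x))
    ...   | red   , p = ⊥-elim (x⁺↛x (p ++ edge x⁻→x))
    ...   | blue  , p = ⊥-elim (x↛x⁻ (edge (arcs x , proj₁ (splits-all ¬from (succ≢ x)) (arcs x)) ++ p))
    ...   | green , p = ⊥-elim (green-bridge noT₃ no-green-into-x (λ _ → splits-all ¬from) p
                                 (arcs x , proj₁ (splits-all ¬from (succ≢ x)) (arcs x)) x⁻→x)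

    -- Now let b = back (2 + k) be the first vertex behind x⁻ not reaching x in
    -- red (it exists since x⁺ does not reach x).  Beyond b, up to x⁺, every vertex reaches x in blue; so in the
    -- interval from x forwards to b, x dominates b by a path whose first arc
    -- must go straight to b, in blue.  But then b reaches x in red.
    module FirstEscape (k : ℕ) (k≤last : 2+ k ≤ last) (¬red-to : ¬ RedTo (back (2+ k)))
                       (red-to-before : RedTo (back (suc k))) where
      b : Fin n
      b = back (2+ k)

      ¬red-from : ¬ RedFrom b
      ¬red-from = red-break red-to-before

      b<last : 2+ k < last
      b<last = ≤∧≢⇒< k≤last (λ e → ¬red-from (subst RedFrom (sym (trans (cong back e) back-last)) x⁺-red-reachable))

      blue-to-beyond : ∀ {i} → 2+ k ≤ i → i < last → BlueTo (back i)
      blue-to-beyond = induction-upward {P = BlueTo ∘ back} blue-to-b ascend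
        where
        blue-to-b : BlueTo b
        blue-to-b with reaches-x (back≢x (s≤s z≤n) k≤last) (back≢x⁺ b<last)
        ... | inj₁ to = ⊥-elim (¬red-to to)
        ... | inj₂ to = to
        ascend : ∀ {i} → 2+ k ≤ i → suc i < last → BlueTo (back i) → BlueTo (back (suc i))
        ascend 2+k≤i si<last to with reaches-x (back≢x (s≤s z≤n) (<⇒≤ si<last)) (back≢x⁺ si<last)
        ... | inj₂ to' = to'
        ... | inj₁ to' = ⊥-elim (not-both to' (blue-to⇒red-from-pred to
                                  (back≢x (≤-trans (s≤s z≤n) 2+k≤i) (<⇒≤ (<-trans (n<1+n _) si<last)))
                                  (back≢x⁺ (<-trans (n<1+n _) si<last))))

      Beyond : Fin n → Set
      Beyond w = w ≡ x ⊎ 2+ k ≤ pos w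

      beyond? : Decidable Beyond
      beyond? w = (w ≟ x) ⊎-dec (2+ k ≤? pos w)

      beyond-pred-closed : ∀ {p} → Beyond p → p ≢ x → Beyond (pred p)
      beyond-pred-closed (inj₁ p≡x) p≢x = ⊥-elim (p≢x p≡x)
      beyond-pred-closed {p} (inj₂ 2+k≤pos) _ with m≤n⇒m<n∨m≡n (pos-≤-last p)
      ... | inj₁ pos<last = inj₂ (subst (2+ k ≤_) (sym (pos-pred pos<last)) (m≤n⇒m≤1+n 2+k≤pos))
      ... | inj₂ pos≡last = inj₁ (trans (cong pred (trans (pos-determines pos≡last) back-last)) (pred-succ x))

      x⁻∉Beyond : ¬ Beyond x⁻
      x⁻∉Beyond (inj₁ x⁻≡x) = pred≢ x x⁻≡x
      x⁻∉Beyond (inj₂ 2+k≤pos) = two≰one (subst (2+ k ≤_) pos-x⁻ 2+k≤pos)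
        where
        two≰one : ¬ 2+ k ≤ 1
        two≰one (s≤s ())

      blocked : ∀ {i} → 2+ k < i → i ≤ last → ¬ BlueFrom (back i)
      blocked (s≤s 2+k≤i) i≤last = blue-break (blue-to-beyond 2+k≤i i≤last)

      x→b : Arc D blue x b
      x→b with red-or-blue (initial-dominates Beyond beyond? (inj₁ refl) x⁻∉Beyond beyond-pred-closed
                             (inj₂ (subst (2+ k ≤_) (sym (pos-back k≤last)) ≤-refl)) (back≢x (s≤s z≤n) k≤last))
                           green-free-from
      ... | inj₁ p = ⊥-elim (¬red-from (forget p))
      ... | inj₂ p with first-step p
      ...   | _ , x→g , inj₁ refl = x→g
      ...   | _ , x→g , inj₂ (inj₁ refl , _) = ⊥-elim (irrefl x (proj₁ x→g))
      ...   | g , x→g , inj₂ (inj₂ 2+k≤pos , _) with m≤n⇒m<n∨m≡n 2+k≤pos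
      ...     | inj₁ 2+k<pos = ⊥-elim (blocked 2+k<pos (pos-≤-last g) (edge (subst (Arc D blue x) (sym (back-pos g)) x→g)))
      ...     | inj₂ 2+k≡pos = subst (Arc D blue x) (pos-determines (sym 2+k≡pos)) x→g

      contradiction : ⊥
      contradiction = ¬red-to (blue-arc⇒red-to (s≤s z≤n) k≤last x→b (λ _ _ → not-both))

    impossible : ⊥
    impossible with least {P = λ j → 1 ≤ j × ¬ RedTo (back j)} (λ j → (1 ≤? j) ×-dec ¬? (monoPath? red (back j) x))
                          {last} (1≤last , x⁺↛x ∘ subst RedTo back-last)
    ... | zero , _ , (() , _) , _
    ... | suc zero , _ , (_ , ¬red-to) , _ = ¬red-to (edge x⁻→x)
    ... | 2+ k , k≤last , (_ , ¬red-to) , below =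
      FirstEscape.contradiction k k≤last ¬red-to
        (decidable-stable (monoPath? red _ x) (λ ¬red-to' → below ≤-refl (s≤s z≤n , ¬red-to')))

  module WithRedCycle (cycle : RedFrom x) where

    OnRedCycle : Fin n → Set
    OnRedCycle w = RedTo w × RedFrom w × w ≢ x

    onRedCycle? : Decidable OnRedCycle
    onRedCycle? w = monoPath? red w x ×-dec (monoPath? red x w ×-dec ¬? (w ≟ x))

    -- The first vertex of the walk after x lies in R⁺_r(x).
    out-neighbour : Σ (Fin n) λ v → R⁺ᵣ D x v
    out-neighbour with first-step cycle
    ... | _ , x→g , inj₁ refl       = ⊥-elim (irrefl x (proj₁ x→g))
    ... | g , x→g , inj₂ (_ , g→x) = g , x→g , g→x

    -- Let v = back (2 + k) be the vertex of a red closed walk through x that is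
    -- closest to x backwards along C (it is neither x nor x⁻).
    module Closest (k : ℕ) (k≤last : 2+ k ≤ last) (on-cycle : OnRedCycle (back (2+ k)))
                   (below : ∀ {i} → i < 2+ k → ¬ OnRedCycle (back i)) where
      v : Fin n
      v = back (2+ k)

      v<last : 2+ k < last
      v<last = ≤∧≢⇒< k≤last (λ e → x⁺↛x (subst RedTo (trans (cong back e) back-last) (proj₁ on-cycle)))

      -- In the interval from v forwards to x, v dominates x; the path is red
      -- (blue would let v reach x in both colours), and its last vertex other
      -- than x would be a closer vertex on a red closed walk unless it is v.
      v→x : Arc D red v x
      v→x with red-or-blue (segment-dominates z≤n k≤last x⁺∉Seg x∈Seg (proj₂ (proj₂ on-cycle) ∘ sym)) green-free-into
        where
        x⁺∉Seg : ¬ Seg 0 (2+ k) x⁺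
        x⁺∉Seg (_ , last≤) = <⇒≱ v<last last≤
        x∈Seg : Seg 0 (2+ k) x
        x∈Seg = z≤n , subst (_≤ 2+ k) (sym pos-x) z≤n
      ... | inj₂ p = ⊥-elim (red-and-blue-to (proj₁ on-cycle) (forget p) (proj₂ (proj₂ on-cycle)))
      ... | inj₁ p with last-step p
      ...   | _ , w→x , inj₁ refl = w→x
      ...   | w , w→x , inj₂ ((_ , pos≤) , v⇝w) with m≤n⇒m<n∨m≡n pos≤
      ...     | inj₂ pos≡ = subst (λ t → Arc D red t x) (pos-determines pos≡) w→x
      ...     | inj₁ pos< = ⊥-elim (below pos< (subst OnRedCycle (sym (back-pos w)) w-on-cycle))
        where
        w-on-cycle : OnRedCycle w
        w-on-cycle = edge w→x , proj₁ (proj₂ on-cycle) ++ forget v⇝w ,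
                     λ w≡x → irrefl x (subst (λ t → arc t x) w≡x (proj₁ w→x))

      -- A blue arc x → v⁺ = back (1 + k) would make v⁺ reach x in red, and
      -- through x its predecessor v.
      no-blue-arc : ¬ B⁺ D x (succ v)
      no-blue-arc x→v⁺ = red-break (blue-arc⇒red-to (s≤s z≤n) (<⇒≤ k≤last) x→back-suc-k off-cycle)
                                   (proj₁ (proj₂ on-cycle))
        where
        x→back-suc-k : Arc D blue x (back (suc k))
        x→back-suc-k = subst (Arc D blue x) (succ-pred (back (suc k))) x→v⁺
        off-cycle : OffRedCyclesBelow (suc k)
        off-cycle 1≤i i<k to from =
          below (<-trans i<k (n<1+n _)) (to , from , back≢x 1≤i (<⇒≤ (<-≤-trans i<k (<⇒≤ k≤last))))

      in-neighbour : Σ (Fin n) λ v → R⁻ᵣ D x v × ¬ B⁺ D x (succ v)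
      in-neighbour = v , (v→x , proj₁ (proj₂ on-cycle)) , no-blue-arc

    in-neighbour : Σ (Fin n) λ v → R⁻ᵣ D x v × ¬ B⁺ D x (succ v)
    in-neighbour with out-neighbour
    ... | r , x→r , r→x with least {P = OnRedCycle ∘ back} (onRedCycle? ∘ back) {pos r} (subst OnRedCycle (sym (back-pos r)) r-on-cycle)
      where
      r-on-cycle : OnRedCycle r
      r-on-cycle = r→x , edge x→r , λ r≡x → irrefl x (subst (arc x) r≡x (proj₁ x→r))
    ...   | zero , _ , (_ , _ , x≢x) , _ = ⊥-elim (x≢x refl)
    ...   | suc zero , _ , (_ , x⇝x⁻ , _) , _ = ⊥-elim (x↛x⁻ x⇝x⁻)
    ...   | 2+ k , j≤pos , on-cycle , below =
      Closest.in-neighbour k (≤-trans j≤pos (pos-≤-last r)) on-cycle below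

  theorem : (Σ (Fin n) λ v → R⁺ᵣ D x v) × (Σ (Fin n) λ v → R⁻ᵣ D x v) ×
            (Σ (Fin n) λ v → R⁻ᵣ D x v × ¬ B⁺ D x (succ v))
  theorem with monoPath? red x x
  ... | no no-cycle = ⊥-elim (WithoutRedCycle.impossible no-cycle)
  ... | yes cycle with WithRedCycle.in-neighbour cycle
  ...   | v , v∈R⁻ᵣ , no-blue = WithRedCycle.out-neighbour cycle , (v , v∈R⁻ᵣ) , (v , v∈R⁻ᵣ , no-blue)

lemma3p4 : {n : ℕ} (D : Tournament n) → MinimalCounterexample D →
    (C : HamiltonCycle D) → DominationCycle D C →
    (x : Fin n) → NoGreenAt D x → R⁻ D x (HamiltonCycle.pred C x) →
    (Σ (Fin n) λ v → R⁺ᵣ D x v) × (Σ (Fin n) λ v → R⁻ᵣ D x v) ×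
    (Σ (Fin n) λ v → R⁻ᵣ D x v × ¬ B⁺ D x (HamiltonCycle.succ C v))
lemma3p4 D M C DC x no-green x⁻→x = AtGreenFreeVertex.theorem M C DC x no-green x⁻→x
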